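{- Let $w=[i_1,j_1][i_2,j_2]\cdots[i_p,j_p]$ be a fully commutative element of $W(A_n)$ in canonical form. Define strictly decreasing sequences $i_1^\ast>\cdots>i^\ast_{n-p}$ and $j_1^\ast>\cdots>j^\ast_{n-p}$ by $$\{i_1^\ast,\dots,i_{n-p}^\ast\}\cup\{j_1,\dots,j_p\}=\{j_1^\ast,\dots,j_{n-p}^\ast\}\cup\{i_1,\dots,i_p\}=\{1,\dots,n\}$$ (disjoint unions), and let $w^\ast=[i_1^\ast,j_1^\ast][i_2^\ast,j_2^\ast]\cdots[i^\ast_{n-p},j^\ast_{n-p}]$. Then $w^\ast$ is a fully commutative element of $W(A_n)$ (in canonical form), and $w\mapsto w^\ast$ is an involutive bijection of the set of FC elements of $W(A_n)$ that maps elements of size $p$ onto elements of size $n-p$, with $\ell(w)-\ell(w^\ast)=2p-n$. In particular, the number of FC elements of size $p$ equals the number of FC elements of size $n-p$.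
   Context: $W(A_n)$: Coxeter group with generators $\sigma_1,\dots,\sigma_n$ of type $A_n$; $\ell$ denotes length. FC = fully commutative (reduced expressions related by commutations only). $[i,j]=\sigma_i\cdots\sigma_j$. Every FC element has a unique canonical form $[i_1,j_1]\cdots[i_p,j_p]$ with $0\le p\le n$, $n\ge j_1>\cdots>j_p\ge1$, $n\ge i_1>\cdots>i_p\ge1$, $j_t\ge i_t$, and every such expression defines an FC element; $p$ is its size. -}

module Defs where

open import Data.Nat using (ℕ; zero; suc; _+_; _∸_; _≤_; _<_; _≟_)
open import Data.Product using (Σ; _×_; _,_; proj₁; proj₂)
open import Data.List using (List; []; _∷_; map; upTo; downFrom; filter; zip; concatMap; length)
open import Data.List.Relation.Unary.All using (All)
open import Data.List.Relation.Unary.Linked using (Linked)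
open import Data.List.Membership.DecPropositional _≟_ using (_∈?_)
open import Relation.Nullary using (¬?; does)
open import Relation.Binary.PropositionalEquality using (_≡_)
open import Data.Bool using (if_then_else_)

-- W(A_n) is realised faithfully as S_{n+1} acting on {1,…,n+1}:
-- σ_i is the transposition (i, i+1).  Words are lists of generator indices.
swap : ℕ → ℕ → ℕ
swap i x = if does (x ≟ i) then suc i else (if does (x ≟ suc i) then i else x)

act : List ℕ → ℕ → ℕ
act [] x = x
act (a ∷ as) x = swap a (act as x)

Word : ℕ → List ℕ → Set
Word n v = All (λ a → 1 ≤ a × a ≤ n) v

_~_ : List ℕ → List ℕ → Set
u ~ v = ∀ x → act u x ≡ act v x

IsLength : ℕ → List ℕ → ℕ → Set
IsLength n u k =
  Σ (List ℕ) (λ v → Word n v × length v ≡ k × v ~ u)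
  × (∀ v → Word n v → v ~ u → k ≤ length v)

-- [i,j] = σ_i σ_{i+1} ⋯ σ_j
interval : ℕ → ℕ → List ℕ
interval i j = map (i +_) (upTo (suc (j ∸ i)))

toWord : List (ℕ × ℕ) → List ℕ
toWord = concatMap (λ ij → interval (proj₁ ij) (proj₂ ij))

Canonical : ℕ → List (ℕ × ℕ) → Set
Canonical n w =
  All (λ ij → 1 ≤ proj₁ ij × proj₁ ij ≤ proj₂ ij × proj₂ ij ≤ n) w
  × Linked (λ ij kl → proj₁ kl < proj₁ ij × proj₂ kl < proj₂ ij) w

complDec : ℕ → List ℕ → List ℕ
complDec n S = filter (λ x → ¬? (x ∈? S)) (map suc (downFrom n))

star : ℕ → List (ℕ × ℕ) → List (ℕ × ℕ)
star n w = zip (complDec n (map proj₂ w)) (complDec n (map proj₁ w))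

-- W(A_n) acts on ℕ, σ_a swapping a and a + 1.  Composing with σ_a changes the
-- number of inversions of a permutation by exactly one, so the inversion number bounds the
-- length of every word from below; and in the word of [i₁,j₁]⋯[i_p,j_p] every letter creates
-- a new inversion, so ℓ(w) = Σ_t (j_t − i_t + 1).
--
-- The canonical-form conditions say that i and j list subsets of {1,…,n} of equal size,
-- decreasingly, with i_t ≤ j_t.  Reading m = n, …, 1, let the height rise at every j_t and
-- fall at every i_t: the condition i_t ≤ j_t says that the height never becomes negative.
-- The pair (i*, j*) = ({1,…,n} ∖ j, {1,…,n} ∖ i) has the same rises and falls, so w* is
-- canonical, and complementing twice gives back w.  Finally Σ i + Σ j* = Σ j + Σ i*
-- = n(n+1)/2 turns the length formula into ℓ(w) − ℓ(w*) = p − (n − p).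
module Submission where

open import Defs
open import Data.Nat using (ℕ; _∸_)
open import Data.Integer using (ℤ; +_; _-_; _*_)
open import Data.Product using (Σ; _×_; _,_)
open import Data.List using (List; length)
open import Relation.Binary.PropositionalEquality using (_≡_)

open import Data.Nat using (zero; suc; _+_; _⊓_; _≤_; _<_; _>_; _≟_; _<?_; s≤s; z≤n; z<s)
open import Data.Bool using (if_then_else_)
open import Data.Empty using (⊥-elim)
import Data.Integer as ℤ
open import Data.Integer.Tactic.RingSolver using () renaming (solve-∀ to ℤ-solve-∀)
open import Data.List using ([]; _∷_; _++_; applyUpTo; drop; map; zip)
open import Data.List.Membership.DecPropositional _≟_ using (_∈_; _∉_; _∈?_)
open import Data.List.Properties
  using (map-applyUpTo; length-++; length-map; length-zipWith; filter-accept; filter-reject)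
open import Data.List.Relation.Binary.Pointwise as Pointwise using (Pointwise; []; _∷_)
open import Data.List.Relation.Unary.All as All using (All; []; _∷_)
import Data.List.Relation.Unary.All.Properties as Allₚ
import Data.List.Relation.Unary.AllPairs as AllPairs
open import Data.List.Relation.Unary.Any using (here; there)
open import Data.List.Relation.Unary.Linked as Linked using (Linked; []; [-]; _∷_)
import Data.List.Relation.Unary.Linked.Properties as Linkedₚ
open import Data.Nat.ListAction using (sum)
open import Data.Nat.Properties
open import Algebra.Properties.CommutativeSemigroup +-commutativeSemigroup using (x∙yz≈y∙xz)
open import Data.Nat.Tactic.RingSolver using (solve-∀)
open import Data.Product as Product using (proj₁; proj₂)
open import Data.Sum using (_⊎_; inj₁; inj₂)
open import Function using (_∘_; flip)
open import Relation.Binary using (tri<; tri≈; tri>)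
open import Relation.Binary.PropositionalEquality
  using (refl; sym; trans; subst; subst₂; cong; cong₂; _≢_; ≢-sym; module ≡-Reasoning)
open import Relation.Nullary using (Dec; ¬_; ¬?; yes; no; does)
open import Relation.Nullary.Decidable using (dec-true; dec-false)

-- Generators as permutations of ℕ

data SwapView (a : ℕ) : ℕ → ℕ → Set where
  at-self : SwapView a a (suc a)
  at-suc  : SwapView a (suc a) a
  elsewhere : ∀ {x} → x ≢ a → x ≢ suc a → SwapView a x x

swap-self : ∀ a → swap a a ≡ suc a
swap-self a rewrite dec-true (a ≟ a) refl = refl

swap-suc : ∀ a → swap a (suc a) ≡ a
swap-suc a rewrite dec-false (suc a ≟ a) (>⇒≢ (n<1+n a)) | dec-true (suc a ≟ suc a) refl =
  refl

swap-elsewhere : ∀ {a x} → x ≢ a → x ≢ suc a → swap a x ≡ x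
swap-elsewhere {a} {x} x≢a x≢1+a rewrite dec-false (x ≟ a) x≢a | dec-false (x ≟ suc a) x≢1+a =
  refl

swap-view : ∀ a x → SwapView a x (swap a x)
swap-view a x with x ≟ a | x ≟ suc a
... | yes refl | _        = subst (SwapView a a) (sym (swap-self a)) at-self
... | no _     | yes refl = subst (SwapView a (suc a)) (sym (swap-suc a)) at-suc
... | no x≢a   | no x≢1+a =
  subst (SwapView a x) (sym (swap-elsewhere x≢a x≢1+a)) (elsewhere x≢a x≢1+a)

swap-involutive : ∀ a x → swap a (swap a x) ≡ x
swap-involutive a x with swap a x | swap-view a x
... | _ | at-self = swap-suc a
... | _ | at-suc = swap-self a
... | _ | elsewhere x≢a x≢1+a = swap-elsewhere x≢a x≢1+a

swap-injective : ∀ a {x y} → swap a x ≡ swap a y → x ≡ y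
swap-injective a {x} {y} eq = begin
  x                   ≡⟨ swap-involutive a x ⟨
  swap a (swap a x)   ≡⟨ cong (swap a) eq ⟩
  swap a (swap a y)   ≡⟨ swap-involutive a y ⟩
  y                   ∎
  where open ≡-Reasoning

swap-fixes : ∀ {a x} → x < a ⊎ suc a < x → swap a x ≡ x
swap-fixes (inj₁ x<a) = swap-elsewhere (<⇒≢ x<a) (<⇒≢ (m<n⇒m<1+n x<a))
swap-fixes (inj₂ 1+a<x) = swap-elsewhere (>⇒≢ (<-trans (n<1+n _) 1+a<x)) (>⇒≢ 1+a<x)

swap-≤ : ∀ {a x b} → a < b → x ≤ b → swap a x ≤ b
swap-≤ {a} {x} a<b x≤b with swap a x | swap-view a x
... | _ | at-self = a<b
... | _ | at-suc = <⇒≤ a<b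
... | _ | elsewhere _ _ = x≤b

swap-<-mono : ∀ {a u v} → ¬ (u ≡ a × v ≡ suc a) → u < v → swap a u < swap a v
swap-<-mono {a} {u} {v} not-pair u<v with swap a u | swap-view a u | swap a v | swap-view a v
... | _ | at-self | _ | at-self = ⊥-elim (<-irrefl refl u<v)
... | _ | at-self | _ | at-suc = ⊥-elim (not-pair (refl , refl))
... | _ | at-self | _ | elsewhere v≢a v≢1+a = ≤∧≢⇒< u<v (≢-sym v≢1+a)
... | _ | at-suc | _ | at-self = ⊥-elim (<-asym u<v (n<1+n a))
... | _ | at-suc | _ | at-suc = ⊥-elim (<-irrefl refl u<v)
... | _ | at-suc | _ | elsewhere _ _ = <-trans (n<1+n a) u<v
... | _ | elsewhere _ _ | _ | at-self = m<n⇒m<1+n u<v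
... | _ | elsewhere u≢a _ | _ | at-suc = ≤∧≢⇒< (≤-pred u<v) u≢a
... | _ | elsewhere _ _ | _ | elsewhere _ _ = u<v

act-injective : ∀ v {x y} → act v x ≡ act v y → x ≡ y
act-injective []      eq = eq
act-injective (a ∷ v) eq = act-injective v (swap-injective a eq)

act⁻¹ : List ℕ → ℕ → ℕ
act⁻¹ []      x = x
act⁻¹ (a ∷ v) x = act⁻¹ v (swap a x)

act-act⁻¹ : ∀ v x → act v (act⁻¹ v x) ≡ x
act-act⁻¹ []      x = refl
act-act⁻¹ (a ∷ v) x = trans (cong (swap a) (act-act⁻¹ v (swap a x))) (swap-involutive a x)

act⁻¹-≤ : ∀ {v x b} → All (_< b) v → x ≤ b → act⁻¹ v x ≤ b
act⁻¹-≤ []           x≤b = x≤b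
act⁻¹-≤ (a<b ∷ v<b) x≤b = act⁻¹-≤ v<b (swap-≤ a<b x≤b)

act-fixes : ∀ {v x} → All (λ a → x < a ⊎ suc a < x) v → act v x ≡ x
act-fixes []            = refl
act-fixes (away ∷ aways) = trans (cong (swap _) (act-fixes aways)) (swap-fixes away)

act-++ : ∀ u v x → act (u ++ v) x ≡ act u (act v x)
act-++ []      v x = refl
act-++ (a ∷ u) v x = cong (swap a) (act-++ u v x)

-- Inversions

∑< : ℕ → (ℕ → ℕ) → ℕ
∑< zero    g = 0
∑< (suc n) g = ∑< n g + g n

∑<-cong : ∀ {g h} n → (∀ {x} → x < n → g x ≡ h x) → ∑< n g ≡ ∑< n h
∑<-cong zero    g≗h = refl
∑<-cong (suc n) g≗h = cong₂ _+_ (∑<-cong n (g≗h ∘ m<n⇒m<1+n)) (g≗h (n<1+n n))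

∑<-zero : ∀ {g} n → (∀ {x} → x < n → g x ≡ 0) → ∑< n g ≡ 0
∑<-zero zero    g≗0 = refl
∑<-zero (suc n) g≗0 = cong₂ _+_ (∑<-zero n (g≗0 ∘ m<n⇒m<1+n)) (g≗0 (n<1+n n))

∑<-bump : ∀ {g h x₀} n → x₀ < n → g x₀ ≡ suc (h x₀) →
          (∀ {x} → x < n → x ≢ x₀ → g x ≡ h x) → ∑< n g ≡ suc (∑< n h)
∑<-bump {g} {h} {x₀} (suc n) x₀<1+n bump g≗h with n ≟ x₀
... | yes refl = begin
  ∑< n g + g n        ≡⟨ cong₂ _+_ (∑<-cong n (λ x<n → g≗h (m<n⇒m<1+n x<n) (<⇒≢ x<n))) bump ⟩
  ∑< n h + suc (h n)  ≡⟨ +-suc _ _ ⟩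
  suc (∑< n h + h n)  ∎
  where open ≡-Reasoning
... | no n≢x₀ = cong₂ _+_ (∑<-bump n x₀<n bump (g≗h ∘ m<n⇒m<1+n)) (g≗h (n<1+n n) n≢x₀)
  where x₀<n = ≤∧≢⇒< (≤-pred x₀<1+n) (≢-sym n≢x₀)

⟦_<_⟧ : ℕ → ℕ → ℕ
⟦ u < v ⟧ = if does (u <? v) then 1 else 0

⟦<⟧-yes : ∀ {u v} → u < v → ⟦ u < v ⟧ ≡ 1
⟦<⟧-yes {u} {v} u<v rewrite dec-true (u <? v) u<v = refl

⟦<⟧-no : ∀ {u v} → ¬ u < v → ⟦ u < v ⟧ ≡ 0
⟦<⟧-no {u} {v} u≮v rewrite dec-false (u <? v) u≮v = refl

⟦<⟧-cong : ∀ {u v u′ v′} → (u < v → u′ < v′) → (u′ < v′ → u < v) →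
           ⟦ u < v ⟧ ≡ ⟦ u′ < v′ ⟧
⟦<⟧-cong {u} {v} to from with u <? v
... | yes u<v = trans (⟦<⟧-yes u<v) (sym (⟦<⟧-yes (to u<v)))
... | no u≮v  = trans (⟦<⟧-no u≮v) (sym (⟦<⟧-no (u≮v ∘ from)))

inversions : (ℕ → ℕ) → ℕ → ℕ
inversions f n = ∑< n (λ y → ∑< y (λ x → ⟦ f y < f x ⟧))

inversions-cong : ∀ {f g} n → (∀ x → f x ≡ g x) → inversions f n ≡ inversions g n
inversions-cong n f≗g = ∑<-cong n λ {y} _ → ∑<-cong y λ _ → cong₂ ⟦_<_⟧ (f≗g _) (f≗g _)

inversions-id : ∀ n → inversions (λ x → x) n ≡ 0
inversions-id n = ∑<-zero n λ {y} _ → ∑<-zero y λ x<y → ⟦<⟧-no (<-asym x<y)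

⟦swap<swap⟧ : ∀ {a u v} → ¬ (u ≡ a × v ≡ suc a) → ¬ (u ≡ suc a × v ≡ a) →
              ⟦ swap a u < swap a v ⟧ ≡ ⟦ u < v ⟧
⟦swap<swap⟧ {a} {u} {v} not-pair not-swapped-pair =
  ⟦<⟧-cong (λ su<sv → subst₂ _<_ (swap-involutive a u) (swap-involutive a v)
                                  (swap-<-mono swapped-not-pair su<sv))
           (swap-<-mono not-pair)
  where
    unswap : ∀ {x y} → swap a x ≡ y → x ≡ swap a y
    unswap {x} refl = sym (swap-involutive a x)
    swapped-not-pair : ¬ (swap a u ≡ a × swap a v ≡ suc a)
    swapped-not-pair (su≡a , sv≡1+a) =
      not-swapped-pair (trans (unswap su≡a) (swap-self a) , trans (unswap sv≡1+a) (swap-suc a))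

-- Only the pair (x₀, y₀) changes its order.
inversions-swap : ∀ {f a x₀ y₀} n → (∀ {x y} → f x ≡ f y → x ≡ y) →
                  f x₀ ≡ a → f y₀ ≡ suc a → x₀ < y₀ → y₀ < n →
                  inversions (swap a ∘ f) n ≡ suc (inversions f n)
inversions-swap {f} {a} {x₀} {y₀} n f-injective fx₀ fy₀ x₀<y₀ y₀<n =
  ∑<-bump n y₀<n
    (∑<-bump y₀ x₀<y₀ flipped (λ x<y₀ x≢x₀ → unchanged x<y₀ (λ _ → x≢x₀)))
    (λ {y} _ y≢y₀ → ∑<-cong y (λ x<y → unchanged x<y (⊥-elim ∘ y≢y₀)))
  where
    flipped : ⟦ swap a (f y₀) < swap a (f x₀) ⟧ ≡ suc ⟦ f y₀ < f x₀ ⟧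
    flipped rewrite fx₀ | fy₀ | swap-suc a | swap-self a =
      trans (⟦<⟧-yes (n<1+n a)) (cong suc (sym (⟦<⟧-no (<-asym (n<1+n a)))))
    unchanged : ∀ {x y} → x < y → (y ≡ y₀ → x ≢ x₀) →
                ⟦ swap a (f y) < swap a (f x) ⟧ ≡ ⟦ f y < f x ⟧
    unchanged {x} {y} x<y not-x₀y₀ = ⟦swap<swap⟧
      (λ (fy≡a , fx≡1+a) → <-asym x<y (subst₂ _<_ (f-injective (trans fx₀ (sym fy≡a)))
                                                   (f-injective (trans fy₀ (sym fx≡1+a))) x₀<y₀))
      (λ (fy≡1+a , fx≡a) → not-x₀y₀ (f-injective (trans fy≡1+a (sym fy₀)))
                                    (f-injective (trans fx≡a (sym fx₀))))

inversions-swap-≤ : ∀ {f a x₀ y₀} n → (∀ {x y} → f x ≡ f y → x ≡ y) →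
                    f x₀ ≡ a → f y₀ ≡ suc a → x₀ < n → y₀ < n →
                    inversions (swap a ∘ f) n ≤ suc (inversions f n)
inversions-swap-≤ {f} {a} {x₀} {y₀} n f-injective fx₀ fy₀ x₀<n y₀<n with <-cmp x₀ y₀
... | tri< x₀<y₀ _ _ = ≤-reflexive (inversions-swap n f-injective fx₀ fy₀ x₀<y₀ y₀<n)
... | tri≈ _ refl _ = ⊥-elim (>⇒≢ (n<1+n a) (trans (sym fy₀) fx₀))
... | tri> _ _ y₀<x₀ = begin
  inversions (swap a ∘ f) n
    ≤⟨ n≤1+n _ ⟩
  suc (inversions (swap a ∘ f) n)
    ≡⟨ inversions-swap n (f-injective ∘ swap-injective a) gy₀ gx₀ y₀<x₀ x₀<n ⟨
  inversions (swap a ∘ swap a ∘ f) n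
    ≡⟨ inversions-cong n (swap-involutive a ∘ f) ⟩
  inversions f n
    ≤⟨ n≤1+n _ ⟩
  suc (inversions f n) ∎
  where
    open ≤-Reasoning
    gy₀ : swap a (f y₀) ≡ a
    gy₀ = trans (cong (swap a) fy₀) (swap-suc a)
    gx₀ : swap a (f x₀) ≡ suc a
    gx₀ = trans (cong (swap a) fx₀) (swap-self a)

inversions≤length : ∀ {n} v → Word n v → inversions (act v) (2 + n) ≤ length v
inversions≤length {n} []      _ = ≤-reflexive (inversions-id (2 + n))
inversions≤length {n} (a ∷ v) ((_ , a≤n) ∷ v-word) = ≤-trans
  (inversions-swap-≤ (2 + n) (act-injective v) (act-act⁻¹ v a) (act-act⁻¹ v (suc a))
                     (preimage< (m≤n⇒m≤1+n a≤n)) (preimage< (s≤s a≤n)))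
  (s≤s (inversions≤length v v-word))
  where
    preimage< : ∀ {x} → x ≤ suc n → act⁻¹ v x < 2 + n
    preimage< x≤1+n = s≤s (act⁻¹-≤ (All.map (s≤s ∘ proj₂) v-word) x≤1+n)

-- Lengths of canonical words

segment : ℕ → ℕ → List ℕ
segment c zero    = []
segment c (suc l) = c ∷ segment (suc c) l

length-segment : ∀ c l → length (segment c l) ≡ l
length-segment c zero    = refl
length-segment c (suc l) = cong suc (length-segment (suc c) l)

applyUpTo-segment : ∀ f c l → (∀ k → f k ≡ c + k) → applyUpTo f l ≡ segment c l
applyUpTo-segment f c zero    f≗c+ = refl
applyUpTo-segment f c (suc l) f≗c+ = cong₂ _∷_ (trans (f≗c+ 0) (+-identityʳ c))
  (applyUpTo-segment (f ∘ suc) (suc c) l (λ k → trans (f≗c+ (suc k)) (+-suc c k)))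

interval-segment : ∀ i j → interval i j ≡ segment i (suc (j ∸ i))
interval-segment i j =
  trans (map-applyUpTo (λ k → k) (λ k → i + k) _)
        (applyUpTo-segment (λ k → i + k) i _ (λ _ → refl))

segment-All : ∀ {P : ℕ → Set} c l → (∀ {k} → c ≤ k → k < c + l → P k) →
              All P (segment c l)
segment-All c zero    _ = []
segment-All c (suc l) p = p ≤-refl (m<m+n c z<s)
  ∷ segment-All (suc c) l (λ {k} 1+c≤k k<1+c+l →
      p (<⇒≤ 1+c≤k) (subst (k <_) (sym (+-suc c l)) k<1+c+l))

act-segment-top : ∀ c l → act (segment c l) (c + l) ≡ c
act-segment-top c zero    = +-identityʳ c
act-segment-top c (suc l) rewrite +-suc c l = trans (cong (swap c) (act-segment-top (suc c) l)) (swap-suc c)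

act-segment-below : ∀ {x} c l → x < c → act (segment c l) x ≡ x
act-segment-below c l x<c = act-fixes (segment-All c l (λ c≤k _ → inj₁ (<-≤-trans x<c c≤k)))

i+[1+j∸i]≡1+j : ∀ {i j} → i ≤ j → i + suc (j ∸ i) ≡ suc j
i+[1+j∸i]≡1+j {i} i≤j = trans (+-suc i _) (cong suc (m+[n∸m]≡n i≤j))

interval-All : ∀ {P : ℕ → Set} {i j} → i ≤ j → (∀ {k} → i ≤ k → k ≤ j → P k) →
               All P (interval i j)
interval-All {P} {i} {j} i≤j p = subst (All P) (sym (interval-segment i j))
  (segment-All i (suc (j ∸ i)) (λ {k} i≤k k<i+1+[j∸i] →
     p i≤k (≤-pred (subst (k <_) (i+[1+j∸i]≡1+j i≤j) k<i+1+[j∸i]))))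

length-interval : ∀ i j → length (interval i j) ≡ suc (j ∸ i)
length-interval i j = trans (cong length (interval-segment i j)) (length-segment i _)

toWord-All : ∀ {P : ℕ → Set} {w} →
             All (λ (i , j) → i ≤ j × (∀ {k} → i ≤ k → k ≤ j → P k)) w →
             All P (toWord w)
toWord-All []               = []
toWord-All ((i≤j , p) ∷ ps) = Allₚ.++⁺ (interval-All i≤j p) (toWord-All ps)

-- The rest of the word sends act⁻¹ r c < j + 1 to c and j + 1 to c + 1, so the letter c adds
-- an inversion.
inversions-segment : ∀ {n j r} → suc j < n → All (_< j) r → ∀ c l → c + l ≡ suc j →
                     inversions (act (segment c l ++ r)) n ≡ l + inversions (act r) n
inversions-segment _ _ c zero _ = refl
inversions-segment {n} {j} {r} 1+j<n r<j c (suc l) c+1+l≡1+j = begin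
  inversions (swap c ∘ π) n
    ≡⟨ inversions-swap n (act-injective (segment (suc c) l ++ r)) πx₀ πy₀ x₀<y₀ 1+j<n ⟩
  suc (inversions π n)
    ≡⟨ cong suc (inversions-segment 1+j<n r<j (suc c) l 1+c+l≡1+j) ⟩
  suc (l + inversions (act r) n) ∎
  where
    open ≡-Reasoning
    π = act (segment (suc c) l ++ r)
    1+c+l≡1+j : suc c + l ≡ suc j
    1+c+l≡1+j = trans (sym (+-suc c l)) c+1+l≡1+j
    x₀ = act⁻¹ r c
    x₀<y₀ : x₀ < suc j
    x₀<y₀ = s≤s (act⁻¹-≤ r<j (≤-pred (subst (c <_) c+1+l≡1+j (m<m+n c z<s))))
    πx₀ : π x₀ ≡ c
    πx₀ = begin
      π x₀                                   ≡⟨ act-++ (segment (suc c) l) r x₀ ⟩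
      act (segment (suc c) l) (act r x₀)     ≡⟨ cong (act (segment (suc c) l)) (act-act⁻¹ r c) ⟩
      act (segment (suc c) l) c              ≡⟨ act-segment-below (suc c) l (n<1+n c) ⟩
      c                                      ∎
    πy₀ : π (suc j) ≡ suc c
    πy₀ = begin
      π (suc j)
        ≡⟨ act-++ (segment (suc c) l) r (suc j) ⟩
      act (segment (suc c) l) (act r (suc j))
        ≡⟨ cong (act (segment (suc c) l)) (act-fixes (All.map (inj₂ ∘ s≤s) r<j)) ⟩
      act (segment (suc c) l) (suc j)
        ≡⟨ cong (act (segment (suc c) l)) 1+c+l≡1+j ⟨
      act (segment (suc c) l) (suc c + l)
        ≡⟨ act-segment-top (suc c) l ⟩
      suc c ∎

IntervalIn : ℕ → ℕ × ℕ → Set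
IntervalIn n (i , j) = 1 ≤ i × i ≤ j × j ≤ n

Canonical-tail : ∀ {n ij w} → Canonical n (ij ∷ w) → Canonical n w
Canonical-tail (_ ∷ bounds , linked) = bounds , Linked.tail linked

Canonical-below-head : ∀ {n i j w} → Canonical n ((i , j) ∷ w) → All (λ kl → proj₂ kl < j) w
Canonical-below-head (_ , linked) =
  AllPairs.head (Linkedₚ.Linked⇒AllPairs (λ y<x z<y → <-trans z<y y<x) (Linked.map proj₂ linked))

toWord-Word : ∀ {n w} → All (IntervalIn n) w → Word n (toWord w)
toWord-Word = toWord-All ∘ All.map λ (1≤i , i≤j , j≤n) →
  i≤j , λ {k} i≤k k≤j → ≤-trans 1≤i i≤k , ≤-trans k≤j j≤n

toWord-< : ∀ {n j w} → All (IntervalIn n) w → All (λ kl → proj₂ kl < j) w → All (_< j) (toWord w)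
toWord-< bounds below = toWord-All (All.zipWith
  (λ ((_ , i≤j′ , _) , j′<j) → i≤j′ , λ {k} _ k≤j′ → ≤-<-trans k≤j′ j′<j) (bounds , below))

inversions-toWord : ∀ {n} w → Canonical n w → inversions (act (toWord w)) (2 + n) ≡ length (toWord w)
inversions-toWord {n} []            _ = inversions-id (2 + n)
inversions-toWord {n} ((i , j) ∷ w) C@((_ , i≤j , j≤n) ∷ bounds , _) = begin
  inversions (act (interval i j ++ toWord w)) (2 + n)
    ≡⟨ cong (λ u → inversions (act (u ++ toWord w)) (2 + n)) (interval-segment i j) ⟩
  inversions (act (segment i (suc (j ∸ i)) ++ toWord w)) (2 + n)
    ≡⟨ inversions-segment (s≤s (s≤s j≤n)) (toWord-< bounds (Canonical-below-head C))
                          i (suc (j ∸ i)) (i+[1+j∸i]≡1+j i≤j) ⟩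
  suc (j ∸ i) + inversions (act (toWord w)) (2 + n)
    ≡⟨ cong₂ _+_ (sym (length-interval i j)) (inversions-toWord w (Canonical-tail C)) ⟩
  length (interval i j) + length (toWord w)
    ≡⟨ length-++ (interval i j) ⟨
  length (interval i j ++ toWord w) ∎
  where open ≡-Reasoning

canonical-isLength : ∀ {n w} → Canonical n w → IsLength n (toWord w) (length (toWord w))
canonical-isLength {n} {w} C = (toWord w , toWord-Word (proj₁ C) , refl , λ _ → refl) , minimal
  where
    minimal : ∀ v → Word n v → v ~ toWord w → length (toWord w) ≤ length v
    minimal v v-word v~w = begin
      length (toWord w)                    ≡⟨ inversions-toWord w C ⟨
      inversions (act (toWord w)) (2 + n)  ≡⟨ inversions-cong (2 + n) v~w ⟨
      inversions (act v) (2 + n)           ≤⟨ inversions≤length v v-word ⟩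
      length v                             ∎
      where open ≤-Reasoning

length-toWord : ∀ {w} → All (λ ij → proj₁ ij ≤ proj₂ ij) w →
                length (toWord w) + sum (map proj₁ w) ≡ sum (map proj₂ w) + length w
length-toWord [] = refl
length-toWord {(i , j) ∷ w} (i≤j ∷ ≤s) = begin
  length (interval i j ++ toWord w) + (i + sum (map proj₁ w))
    ≡⟨ cong (_+ (i + sum (map proj₁ w)))
            (trans (length-++ (interval i j)) (cong (_+ length (toWord w)) (length-interval i j))) ⟩
  suc (j ∸ i) + length (toWord w) + (i + sum (map proj₁ w))
    ≡⟨ regroup (j ∸ i) (length (toWord w)) i (sum (map proj₁ w)) ⟩
  suc (j ∸ i + i) + (length (toWord w) + sum (map proj₁ w))
    ≡⟨ cong₂ (λ a b → suc a + b) (m∸n+n≡m i≤j) (length-toWord ≤s) ⟩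
  suc j + (sum (map proj₂ w) + length w)
    ≡⟨ regroup′ j (sum (map proj₂ w)) (length w) ⟩
  j + sum (map proj₂ w) + suc (length w) ∎
  where
    open ≡-Reasoning
    regroup : ∀ a b c d → suc a + b + (c + d) ≡ suc (a + c) + (b + d)
    regroup = solve-∀
    regroup′ : ∀ a b c → suc a + (b + c) ≡ a + b + suc c
    regroup′ = solve-∀

-- Decreasing subsets of {1,…,m} and their complements

data DescSubset : ℕ → List ℕ → Set where
  ∅    : DescSubset 0 []
  keep : ∀ {m S} → DescSubset m S → DescSubset (suc m) (suc m ∷ S)
  skip : ∀ {m S} → DescSubset m S → DescSubset (suc m) S

DescSubset-positive : ∀ {m S} → DescSubset m S → All (1 ≤_) S
DescSubset-positive ∅        = []
DescSubset-positive (keep s) = s≤s z≤n ∷ DescSubset-positive s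
DescSubset-positive (skip s) = DescSubset-positive s

DescSubset-≤ : ∀ {m S} → DescSubset m S → All (_≤ m) S
DescSubset-≤ ∅        = []
DescSubset-≤ (keep s) = ≤-refl ∷ All.map m≤n⇒m≤1+n (DescSubset-≤ s)
DescSubset-≤ (skip s) = All.map m≤n⇒m≤1+n (DescSubset-≤ s)

DescSubset-Linked : ∀ {m S} → DescSubset m S → Linked _>_ S
DescSubset-Linked ∅        = []
DescSubset-Linked (keep s) with DescSubset-≤ s | DescSubset-Linked s
... | []        | _      = [-]
... | x≤m ∷ _   | linked = s≤s x≤m ∷ linked
DescSubset-Linked (skip s) = DescSubset-Linked s

Linked>-tail-≤ : ∀ {m x S} → x ≤ suc m → Linked _>_ (x ∷ S) → All (_≤ m) S
Linked>-tail-≤ x≤1+m linked =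
  All.map (λ y<x → ≤-pred (≤-trans y<x x≤1+m))
          (AllPairs.head (Linkedₚ.Linked⇒AllPairs (flip <-trans) linked))

descSubset : ∀ m {S} → All (1 ≤_) S → All (_≤ m) S → Linked _>_ S → DescSubset m S
descSubset zero    []          []          _      = ∅
descSubset (suc m) []          []          _      = skip (descSubset m [] [] [])
descSubset zero    (1≤x ∷ _)   (x≤0 ∷ _)   _      = ⊥-elim (<-irrefl refl (≤-trans 1≤x x≤0))
descSubset (suc m) {x ∷ _} (1≤x ∷ 1≤S) (x≤1+m ∷ _) linked with x ≟ suc m
... | yes refl = keep (descSubset m 1≤S (Linked>-tail-≤ x≤1+m linked) (Linked.tail linked))
... | no x≢1+m =
  skip (descSubset m (1≤x ∷ 1≤S) (x≤m ∷ Linked>-tail-≤ x≤1+m linked) linked)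
  where x≤m = ≤-pred (≤∧≢⇒< x≤1+m x≢1+m)

complDec-∈ : ∀ m {S} → suc m ∈ S → complDec (suc m) S ≡ complDec m S
complDec-∈ m {S} 1+m∈S = filter-reject (λ x → ¬? (x ∈? S)) (λ 1+m∉S → 1+m∉S 1+m∈S)

complDec-∉ : ∀ m {S} → suc m ∉ S → complDec (suc m) S ≡ suc m ∷ complDec m S
complDec-∉ m {S} 1+m∉S = filter-accept (λ x → ¬? (x ∈? S)) 1+m∉S

complDec-∷-above : ∀ m {x S} → m < x → complDec m (x ∷ S) ≡ complDec m S
complDec-∷-above zero    _   = refl
complDec-∷-above (suc m) {x} {S} 1+m<x = by-cases (suc m ∈? S)
  where
    open ≡-Reasoning
    complDec-m : complDec m (x ∷ S) ≡ complDec m S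
    complDec-m = complDec-∷-above m (<-trans (n<1+n m) 1+m<x)
    by-cases : Dec (suc m ∈ S) → complDec (suc m) (x ∷ S) ≡ complDec (suc m) S
    by-cases (yes 1+m∈S) = begin
      complDec (suc m) (x ∷ S)   ≡⟨ complDec-∈ m (there 1+m∈S) ⟩
      complDec m (x ∷ S)         ≡⟨ complDec-m ⟩
      complDec m S               ≡⟨ complDec-∈ m 1+m∈S ⟨
      complDec (suc m) S         ∎
    by-cases (no 1+m∉S) = begin
      complDec (suc m) (x ∷ S)   ≡⟨ complDec-∉ m (λ { (here 1+m≡x) → <-irrefl 1+m≡x 1+m<x
                                                    ; (there 1+m∈S) → 1+m∉S 1+m∈S }) ⟩
      suc m ∷ complDec m (x ∷ S) ≡⟨ cong (suc m ∷_) complDec-m ⟩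
      suc m ∷ complDec m S       ≡⟨ complDec-∉ m 1+m∉S ⟨
      complDec (suc m) S         ∎

complDec-keep : ∀ m S → complDec (suc m) (suc m ∷ S) ≡ complDec m S
complDec-keep m S = trans (complDec-∈ m (here refl)) (complDec-∷-above m (n<1+n m))

complDec-skip : ∀ {m S} → All (_≤ m) S → complDec (suc m) S ≡ suc m ∷ complDec m S
complDec-skip {m} S≤m = complDec-∉ m (1+n≰n ∘ All.lookup S≤m)

DescSubset-complDec : ∀ {m S} → DescSubset m S → DescSubset m (complDec m S)
DescSubset-complDec ∅ = ∅
DescSubset-complDec {suc m} (keep {S = S} s) rewrite complDec-keep m S = skip (DescSubset-complDec s)
DescSubset-complDec (skip s) rewrite complDec-skip (DescSubset-≤ s) = keep (DescSubset-complDec s)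

complDec-involutive : ∀ {m S} → DescSubset m S → complDec m (complDec m S) ≡ S
complDec-involutive ∅ = refl
complDec-involutive {suc m} (keep {S = S} s)
  rewrite complDec-keep m S | complDec-skip (DescSubset-≤ (DescSubset-complDec s)) =
  cong (suc m ∷_) (complDec-involutive s)
complDec-involutive {suc m} (skip {S = S} s)
  rewrite complDec-skip (DescSubset-≤ s) | complDec-keep m (complDec m S) =
  complDec-involutive s

length-complDec : ∀ {m S} → DescSubset m S → length (complDec m S) + length S ≡ m
length-complDec ∅ = refl
length-complDec {suc m} (keep {S = S} s) rewrite complDec-keep m S =
  trans (+-suc _ (length S)) (cong suc (length-complDec s))
length-complDec (skip s) rewrite complDec-skip (DescSubset-≤ s) = cong suc (length-complDec s)

sum-complDec : ∀ {m S} → DescSubset m S → sum S + sum (complDec m S) ≡ sum (complDec m [])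
sum-complDec ∅ = refl
sum-complDec {suc m} (keep {S = S} s) rewrite complDec-keep m S | complDec-skip {m} [] =
  trans (+-assoc (suc m) (sum S) _) (cong (_+_ (suc m)) (sum-complDec s))
sum-complDec {suc m} {S} (skip s) rewrite complDec-skip (DescSubset-≤ s) | complDec-skip {m} [] =
  trans (x∙yz≈y∙xz (sum S) (suc m) _) (cong (_+_ (suc m)) (sum-complDec s))

-- Canonical forms as ballot paths

-- I and J are the i's and j's in {1,…,m}; d counts the j's above m minus the i's above m.
data Ballot : ℕ → ℕ → List ℕ → List ℕ → Set where
  start   : Ballot 0 0 [] []
  both    : ∀ {m d I J} → Ballot m d I J → Ballot (suc m) d (suc m ∷ I) (suc m ∷ J)
  neither : ∀ {m d I J} → Ballot m d I J → Ballot (suc m) d I J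
  onlyJ   : ∀ {m d I J} → Ballot m (suc d) I J → Ballot (suc m) d I (suc m ∷ J)
  onlyI   : ∀ {m d I J} → Ballot m d I J → Ballot (suc m) (suc d) (suc m ∷ I) J

Ballot-DescSubset : ∀ {m d I J} → Ballot m d I J → DescSubset m I × DescSubset m J
Ballot-DescSubset start       = ∅ , ∅
Ballot-DescSubset (both b)    = Product.map keep keep (Ballot-DescSubset b)
Ballot-DescSubset (neither b) = Product.map skip skip (Ballot-DescSubset b)
Ballot-DescSubset (onlyJ b)   = Product.map skip keep (Ballot-DescSubset b)
Ballot-DescSubset (onlyI b)   = Product.map keep skip (Ballot-DescSubset b)

Ballot-complement : ∀ {m d I J} → Ballot m d I J → Ballot m d (complDec m J) (complDec m I)
Ballot-complement start = start
Ballot-complement {suc m} (both {I = I} {J} b)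
  rewrite complDec-keep m I | complDec-keep m J = neither (Ballot-complement b)
Ballot-complement (neither b) with Ballot-DescSubset b
... | sI , sJ rewrite complDec-skip (DescSubset-≤ sI) | complDec-skip (DescSubset-≤ sJ) =
  both (Ballot-complement b)
Ballot-complement {suc m} (onlyJ {J = J} b) with Ballot-DescSubset b
... | sI , _ rewrite complDec-keep m J | complDec-skip (DescSubset-≤ sI) = onlyJ (Ballot-complement b)
Ballot-complement {suc m} (onlyI {I = I} b) with Ballot-DescSubset b
... | _ , sJ rewrite complDec-keep m I | complDec-skip (DescSubset-≤ sJ) = onlyI (Ballot-complement b)

-- The d largest elements of I are paired with j's above m; the other i's lie pointwise below J.
Dominated : ℕ → ℕ → List ℕ → List ℕ → Set
Dominated m d I J =
  DescSubset m I × DescSubset m J × length I ≡ d + length J × Pointwise _≤_ (drop d I) J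

Pointwise-drop-suc : ∀ d {xs y ys} → Pointwise _≤_ (drop d xs) (y ∷ ys) →
                     Pointwise _≤_ (drop (suc d) xs) ys
Pointwise-drop-suc zero    {_ ∷ _}  (_ ∷ xs≤ys) = xs≤ys
Pointwise-drop-suc (suc d) {_ ∷ xs} xs≤ys       = Pointwise-drop-suc d {xs} xs≤ys

Pointwise-drop-cons : ∀ d {b y xs ys k} → All (_≤ b) xs → b ≤ y → length xs ≡ suc d + k →
                      Pointwise _≤_ (drop (suc d) xs) ys → Pointwise _≤_ (drop d xs) (y ∷ ys)
Pointwise-drop-cons zero    (x≤b ∷ _)   b≤y _          xs≤ys = ≤-trans x≤b b≤y ∷ xs≤ys
Pointwise-drop-cons (suc d) (_ ∷ xs≤b) b≤y |xs|≡2+d+k xs≤ys =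
  Pointwise-drop-cons d xs≤b b≤y (suc-injective |xs|≡2+d+k) xs≤ys

dominated⇒ballot : ∀ {m d I J} → Dominated m d I J → Ballot m d I J
dominated⇒ballot {d = zero}  (∅ , ∅ , _ , _) = start
dominated⇒ballot {d = zero}  (keep sI , keep sJ , |I|≡|J| , _ ∷ I≤J) =
  both (dominated⇒ballot (sI , sJ , suc-injective |I|≡|J| , I≤J))
dominated⇒ballot {d = suc d} {J = _ ∷ J} (keep sI , keep sJ , |I|≡d+|J| , I≤J) =
  both (dominated⇒ballot
    (sI , sJ , trans (suc-injective |I|≡d+|J|) (+-suc d (length J)) , Pointwise-drop-suc d I≤J))
dominated⇒ballot {d = zero}  (keep sI , skip sJ , _ , 1+m≤j ∷ _) with DescSubset-≤ sJ
... | j≤m ∷ _ = ⊥-elim (1+n≰n (≤-trans 1+m≤j j≤m))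
dominated⇒ballot {d = suc d} (keep sI , skip sJ , |I|≡d+|J| , I≤J) =
  onlyI (dominated⇒ballot (sI , sJ , suc-injective |I|≡d+|J| , I≤J))
dominated⇒ballot {d = d} {J = _ ∷ J} (skip sI , keep sJ , |I|≡d+|J| , I≤J) =
  onlyJ (dominated⇒ballot
    (sI , sJ , trans |I|≡d+|J| (+-suc d (length J)) , Pointwise-drop-suc d I≤J))
dominated⇒ballot (skip sI , skip sJ , |I|≡d+|J| , I≤J) =
  neither (dominated⇒ballot (sI , sJ , |I|≡d+|J| , I≤J))

ballot⇒dominated : ∀ {m d I J} → Ballot m d I J → Dominated m d I J
ballot⇒dominated start = ∅ , ∅ , refl , []
ballot⇒dominated (both {d = zero} b) with ballot⇒dominated b
... | sI , sJ , |I|≡|J| , I≤J = keep sI , keep sJ , cong suc |I|≡|J| , ≤-refl ∷ I≤J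
ballot⇒dominated (both {d = suc d} b) with ballot⇒dominated b
... | sI , sJ , |I|≡1+d+|J| , I≤J =
  keep sI , keep sJ , cong suc (trans |I|≡1+d+|J| (sym (+-suc d _))) ,
  Pointwise-drop-cons d (DescSubset-≤ sI) (n≤1+n _) |I|≡1+d+|J| I≤J
ballot⇒dominated (neither b) with ballot⇒dominated b
... | sI , sJ , |I|≡d+|J| , I≤J = skip sI , skip sJ , |I|≡d+|J| , I≤J
ballot⇒dominated (onlyJ {d = d} b) with ballot⇒dominated b
... | sI , sJ , |I|≡1+d+|J| , I≤J =
  skip sI , keep sJ , trans |I|≡1+d+|J| (sym (+-suc d _)) ,
  Pointwise-drop-cons d (DescSubset-≤ sI) (n≤1+n _) |I|≡1+d+|J| I≤J
ballot⇒dominated (onlyI b) with ballot⇒dominated b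
... | sI , sJ , |I|≡d+|J| , I≤J = keep sI , skip sJ , cong suc |I|≡d+|J| , I≤J

Ballot-length : ∀ {m d I J} → Ballot m d I J → length I ≡ d + length J
Ballot-length = proj₁ ∘ proj₂ ∘ proj₂ ∘ ballot⇒dominated

Canonical-DescSubset₁ : ∀ {n w} → Canonical n w → DescSubset n (map proj₁ w)
Canonical-DescSubset₁ {n} (bounds , linked) = descSubset n
  (Allₚ.map⁺ (All.map proj₁ bounds))
  (Allₚ.map⁺ (All.map (λ (_ , i≤j , j≤n) → ≤-trans i≤j j≤n) bounds))
  (Linkedₚ.map⁺ (Linked.map proj₁ linked))

Canonical-DescSubset₂ : ∀ {n w} → Canonical n w → DescSubset n (map proj₂ w)
Canonical-DescSubset₂ {n} (bounds , linked) = descSubset n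
  (Allₚ.map⁺ (All.map (λ (1≤i , i≤j , _) → ≤-trans 1≤i i≤j) bounds))
  (Allₚ.map⁺ (All.map (proj₂ ∘ proj₂) bounds))
  (Linkedₚ.map⁺ (Linked.map proj₂ linked))

canonical⇒ballot : ∀ {n w} → Canonical n w → Ballot n 0 (map proj₁ w) (map proj₂ w)
canonical⇒ballot {n} {w} C = dominated⇒ballot
  ( Canonical-DescSubset₁ C
  , Canonical-DescSubset₂ C
  , trans (length-map proj₁ w) (sym (length-map proj₂ w))
  , Pointwise.map⁺ proj₁ proj₂ (diagonal (proj₁ C)) )
  where
    diagonal : ∀ {w} → All (IntervalIn n) w → Pointwise (λ ij kl → proj₁ ij ≤ proj₂ kl) w w
    diagonal []                       = []
    diagonal ((_ , i≤j , _) ∷ bounds) = i≤j ∷ diagonal bounds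

zip-IntervalIn : ∀ {n I J} → All (1 ≤_) I → All (_≤ n) J → Pointwise _≤_ I J →
                 All (IntervalIn n) (zip I J)
zip-IntervalIn []          []          []          = []
zip-IntervalIn (1≤i ∷ 1≤I) (j≤n ∷ J≤n) (i≤j ∷ I≤J) =
  (1≤i , i≤j , j≤n) ∷ zip-IntervalIn 1≤I J≤n I≤J

zip-Linked : ∀ {I J} → Linked _>_ I → Linked _>_ J → Pointwise _≤_ I J →
             Linked (λ ij kl → proj₁ kl < proj₁ ij × proj₂ kl < proj₂ ij) (zip I J)
zip-Linked []           []           []              = []
zip-Linked [-]          [-]          (_ ∷ [])        = [-]
zip-Linked (i>i′ ∷ I>) (j>j′ ∷ J>) (_ ∷ I≤J)       = (i>i′ , j>j′) ∷ zip-Linked I> J> I≤J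

ballot⇒canonical : ∀ {n I J} → Ballot n 0 I J → Canonical n (zip I J)
ballot⇒canonical b with ballot⇒dominated b
... | sI , sJ , _ , I≤J = zip-IntervalIn (DescSubset-positive sI) (DescSubset-≤ sJ) I≤J
                        , zip-Linked (DescSubset-Linked sI) (DescSubset-Linked sJ) I≤J

-- The involution w ↦ w*

map-proj₁-zip : ∀ {A B : Set} (xs : List A) (ys : List B) → length xs ≡ length ys →
                map proj₁ (zip xs ys) ≡ xs
map-proj₁-zip []       []       _          = refl
map-proj₁-zip (x ∷ xs) (y ∷ ys) |xs|≡|ys| =
  cong (x ∷_) (map-proj₁-zip xs ys (suc-injective |xs|≡|ys|))

map-proj₂-zip : ∀ {A B : Set} (xs : List A) (ys : List B) → length xs ≡ length ys →
                map proj₂ (zip xs ys) ≡ ys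
map-proj₂-zip []       []       _          = refl
map-proj₂-zip (x ∷ xs) (y ∷ ys) |xs|≡|ys| =
  cong (y ∷_) (map-proj₂-zip xs ys (suc-injective |xs|≡|ys|))

zip-map-proj : ∀ {A B : Set} (w : List (A × B)) → zip (map proj₁ w) (map proj₂ w) ≡ w
zip-map-proj []      = refl
zip-map-proj (x ∷ w) = cong (x ∷_) (zip-map-proj w)

length-zip : ∀ {A B : Set} (xs : List A) (ys : List B) → length xs ≡ length ys →
             length (zip xs ys) ≡ length xs
length-zip xs ys |xs|≡|ys| =
  trans (length-zipWith _,_ xs ys) (trans (cong (length xs ⊓_) (sym |xs|≡|ys|)) (⊓-idem _))

+-exchange : ∀ {k k* a b a* b* p q} → k + a ≡ b + p → k* + a* ≡ b* + q → a + b* ≡ b + a* →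
             k + q ≡ k* + p
+-exchange {k} {k*} {a} {b} {a*} {b*} {p} {q} e₁ e₂ e₃ = +-cancelʳ-≡ _ (k + q) (k* + p) (begin
  (k + q) + ((b + p) + (k* + a*) + (a + b*))
    ≡⟨ regroup k q b p k* a* a b* ⟩
  (k* + p) + ((k + a) + (b* + q) + (b + a*))
    ≡⟨ cong (_+_ (k* + p)) (cong₂ _+_ (cong₂ _+_ e₁ (sym e₂)) (sym e₃)) ⟩
  (k* + p) + ((b + p) + (k* + a*) + (a + b*)) ∎)
  where
    open ≡-Reasoning
    regroup : ∀ k q b p k* a* a b* →
              (k + q) + ((b + p) + (k* + a*) + (a + b*)) ≡ (k* + p) + ((k + a) + (b* + q) + (b + a*))
    regroup = solve-∀

ℤ-difference : ∀ {k k* p q n} → k + q ≡ k* + p → p + q ≡ n → + k - + k* ≡ + 2 * + p - + n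
ℤ-difference {k} {k*} {p} {q} {n} k+q≡k*+p p+q≡n = begin
  + k - + k*                        ≡⟨ shift (+ k) (+ k*) (+ q) ⟩
  + (k + q) - (+ k* ℤ.+ + q)        ≡⟨ cong (λ x → + x - (+ k* ℤ.+ + q)) k+q≡k*+p ⟩
  + (k* + p) - (+ k* ℤ.+ + q)       ≡⟨ cancel (+ k*) (+ p) (+ q) ⟩
  + 2 * + p - + (p + q)             ≡⟨ cong (λ x → + 2 * + p - + x) p+q≡n ⟩
  + 2 * + p - + n                   ∎
  where
    open ≡-Reasoning
    shift : ∀ x y z → x - y ≡ (x ℤ.+ z) - (y ℤ.+ z)
    shift = ℤ-solve-∀
    cancel : ∀ x y z → (x ℤ.+ y) - (x ℤ.+ z) ≡ + 2 * y - (y ℤ.+ z)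
    cancel = ℤ-solve-∀

module _ {n : ℕ} {w : List (ℕ × ℕ)} (C : Canonical n w) where
  private
    I J I* J* : List ℕ
    I  = map proj₁ w
    J  = map proj₂ w
    I* = complDec n J
    J* = complDec n I
    sI : DescSubset n I
    sI = Canonical-DescSubset₁ C
    sJ : DescSubset n J
    sJ = Canonical-DescSubset₂ C
    ballot* : Ballot n 0 I* J*
    ballot* = Ballot-complement (canonical⇒ballot C)
    |I*|≡|J*| : length I* ≡ length J*
    |I*|≡|J*| = Ballot-length ballot*
    map-proj₁-star : map proj₁ (star n w) ≡ I*
    map-proj₁-star = map-proj₁-zip I* J* |I*|≡|J*|
    map-proj₂-star : map proj₂ (star n w) ≡ J*
    map-proj₂-star = map-proj₂-zip I* J* |I*|≡|J*|

  star-canonical : Canonical n (star n w)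
  star-canonical = ballot⇒canonical ballot*

  star-involutive : star n (star n w) ≡ w
  star-involutive = begin
    zip (complDec n (map proj₂ (star n w))) (complDec n (map proj₁ (star n w)))
      ≡⟨ cong₂ (λ A B → zip (complDec n A) (complDec n B)) map-proj₂-star map-proj₁-star ⟩
    zip (complDec n J*) (complDec n I*)
      ≡⟨ cong₂ zip (complDec-involutive sI) (complDec-involutive sJ) ⟩
    zip I J
      ≡⟨ zip-map-proj w ⟩
    w ∎
    where open ≡-Reasoning

  length-+-length-star : length w + length (star n w) ≡ n
  length-+-length-star = begin
    length w + length (zip I* J*)
      ≡⟨ cong₂ _+_ (sym (length-map proj₂ w)) (length-zip I* J* |I*|≡|J*|) ⟩
    length J + length I*
      ≡⟨ +-comm (length J) (length I*) ⟩
    length I* + length J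
      ≡⟨ length-complDec sJ ⟩
    n ∎
    where open ≡-Reasoning

  length-star : length (star n w) ≡ n ∸ length w
  length-star = begin
    length (star n w)                              ≡⟨ m+n∸m≡n (length w) _ ⟨
    length w + length (star n w) ∸ length w        ≡⟨ cong (_∸ length w) length-+-length-star ⟩
    n ∸ length w                                   ∎
    where open ≡-Reasoning

  length-toWord-star : length (toWord w) + length (star n w) ≡ length (toWord (star n w)) + length w
  length-toWord-star = +-exchange {a = sum I} {b = sum J} {a* = sum I*} {b* = sum J*}
    (length-toWord (All.map (proj₁ ∘ proj₂) (proj₁ C)))
    (subst₂ (λ A B → length (toWord (star n w)) + sum A ≡ sum B + length (star n w))
            map-proj₁-star map-proj₂-star
            (length-toWord (All.map (proj₁ ∘ proj₂) (proj₁ star-canonical))))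
    (trans (sum-complDec sI) (sym (sum-complDec sJ)))

mainTheorem8 : (n : ℕ) (w : List (ℕ × ℕ)) → Canonical n w →
    Canonical n (star n w)
    × star n (star n w) ≡ w
    × length (star n w) ≡ n ∸ length w
    × Σ ℕ (λ k → Σ ℕ (λ k* →
        IsLength n (toWord w) k × IsLength n (toWord (star n w)) k*
        × (+ k) - (+ k*) ≡ (+ 2) * (+ length w) - (+ n)))
mainTheorem8 n w C =
  star-canonical C , star-involutive C , length-star C ,
  length (toWord w) , length (toWord (star n w)) ,
  canonical-isLength C , canonical-isLength (star-canonical C) ,
  ℤ-difference {q = length (star n w)} (length-toWord-star C) (length-+-length-star C)
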